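{- Consider the simultaneous diophantine equations in integers \[ s = x_1^2+y_1^2=x_2^2+y_2^2=\cdots=x_n^2+y_n^2,\qquad s=x_1^2+y_1^2=x_1^2+x_2^2+\cdots+x_n^2. \] (i) For $n\ge 3$ and arbitrary integer $t$, a solution is given by \[ \begin{aligned} (x_1,y_1)=\cdots=(x_{n-2},y_{n-2})&=\big(8t(t^2+1)(t^2-1),\ (n-2)(t^2+1)^3\big),\\ (x_{n-1},y_{n-1})&=\big((t^2-1)((n-2)t^4+(2n-20)t^2+n-2),\ 2t((n+2)t^4+(2n-12)t^2+n+2)\big),\\ (x_n,y_n)&=\big(2t((n-6)t^4+(2n+4)t^2+n-6),\ (t^2-1)((n-2)t^4+(2n+12)t^2+n-2)\big), \end{aligned} \] together with $s=x_1^2+y_1^2$. (ii) For $n=m^2+1$ with $m\ge 2$ an integer and arbitrary integer $t$, a solution is given by \[ (x_1,y_1)=\cdots=(x_{n-1},y_{n-1})=\big(2t,\ (n-2)t^2+1\big),\qquad (x_n,y_n)=\big((n-2)t^2-1,\ 2mt\big), \] together with $s=x_1^2+y_1^2$. -}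

module Defs where

open import Data.Nat as ℕ using (ℕ; zero; suc; _<ᵇ_; _≡ᵇ_)
open import Data.Bool using (if_then_else_)
open import Data.Fin using (Fin; toℕ) renaming (zero to fzero; suc to fsuc)
open import Data.Integer using (ℤ; +_; _+_; _-_; _*_; _^_)
open import Data.Product using (_×_; _,_)
open import Relation.Binary.PropositionalEquality using (_≡_)

∑ : (n : ℕ) → (Fin n → ℤ) → ℤ
∑ zero    f = + 0
∑ (suc n) f = f fzero + ∑ n (λ i → f (fsuc i))

-- (x , y) : Fin n → ℤ × ℤ, index i stands for the pair (x_{i+1}, y_{i+1}).
-- The system  s = x_1²+y_1² = … = x_n²+y_n²  and  s = x_1²+y_1² = x_1²+…+x_n²
-- with s = x_1² + y_1².
IsSolution : (n : ℕ) → (Fin n → ℤ) → (Fin n → ℤ) → ℤ → Set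
IsSolution n x y s =
  ((i : Fin n) → x i ^ 2 + y i ^ 2 ≡ s) × (s ≡ ∑ n (λ i → x i ^ 2))

-- Part (i) family (n ≥ 3): indices 1..n-2, n-1, n  (0-based: < n-2, = n-2, = n-1)
solI-x solI-y : (n : ℕ) → ℤ → Fin n → ℤ
solI-x n t i =
  let N = + n in
  if toℕ i <ᵇ (n ℕ.∸ 2) then + 8 * t * (t ^ 2 + + 1) * (t ^ 2 - + 1)
  else if toℕ i ≡ᵇ (n ℕ.∸ 2)
    then (t ^ 2 - + 1) * ((N - + 2) * t ^ 4 + (+ 2 * N - + 20) * t ^ 2 + N - + 2)
  else + 2 * t * ((N - + 6) * t ^ 4 + (+ 2 * N + + 4) * t ^ 2 + N - + 6)
solI-y n t i =
  let N = + n in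
  if toℕ i <ᵇ (n ℕ.∸ 2) then (N - + 2) * (t ^ 2 + + 1) ^ 3
  else if toℕ i ≡ᵇ (n ℕ.∸ 2)
    then + 2 * t * ((N + + 2) * t ^ 4 + (+ 2 * N - + 12) * t ^ 2 + N + + 2)
  else (t ^ 2 - + 1) * ((N - + 2) * t ^ 4 + (+ 2 * N + + 12) * t ^ 2 + N - + 2)

-- Part (ii) family (n = m²+1): indices 1..n-1 (0-based < n-1), then n
solII-x solII-y : (n m : ℕ) → ℤ → Fin n → ℤ
solII-x n m t i =
  let N = + n in
  if toℕ i <ᵇ (n ℕ.∸ 1) then + 2 * t
  else (N - + 2) * t ^ 2 - + 1
solII-y n m t i =
  let N = + n in
  if toℕ i <ᵇ (n ℕ.∸ 1) then (N - + 2) * t ^ 2 + + 1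
  else + 2 * + m * t

-- s = x_1² + y_1²  (n = 0 never occurs in the statement; value there is irrelevant)
s₁ : (n : ℕ) → (Fin n → ℤ) → (Fin n → ℤ) → ℤ
s₁ zero    x y = + 0
s₁ (suc n) x y = x fzero ^ 2 + y fzero ^ 2

module Submission where

-- Each family is a pair (x₁, y₁) repeated, followed by one or two further pairs, so the system
-- reduces to polynomial identities: every further pair lies on the circle x² + y² = x₁² + y₁²,
-- and x₁² + y₁² equals x₁² counted with its multiplicity plus the squares of the remaining x's.
-- In family (ii) only the circle condition for the last pair needs n − 1 = m².

open import Defs
open import Data.Nat as ℕ using (ℕ; _≤_; suc; s≤s; _<ᵇ_; _≡ᵇ_)
open import Data.Integer using (ℤ; +_; _+_; _-_; _*_; _^_)
open import Data.Integer.Properties using (+-identityˡ; +-identityʳ; +-assoc; suc-*; pos-+; pos-*)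
open import Data.Integer.Solver using (module +-*-Solver)
open import Data.Bool using (true; false; if_then_else_)
open import Data.Fin using (toℕ)
open import Data.Product using (_×_; _,_)
open import Relation.Binary.PropositionalEquality using (_≡_; refl; sym; trans; cong; module ≡-Reasoning)
open +-*-Solver using (Polynomial; solve; _:=_; _:+_; _:-_; _:*_; _:^_; con)

x+[r*x+y]≡[1+r]*x+y : ∀ r x y → x + (+ r * x + y) ≡ + suc r * x + y
x+[r*x+y]≡[1+r]*x+y r x y = begin
  x + (+ r * x + y)   ≡⟨ sym (+-assoc x (+ r * x) y) ⟩
  x + + r * x + y     ≡⟨ cong (_+ y) (sym (suc-* (+ r) x)) ⟩
  + suc r * x + y     ∎
  where open ≡-Reasoning

∑-repeat-then-one : ∀ (h : ℤ → ℤ) r a b →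
  ∑ (suc r) (λ i → h (if toℕ i <ᵇ r then a else b)) ≡ + r * h a + h b
∑-repeat-then-one h 0       a b = trans (+-identityʳ (h b)) (sym (+-identityˡ (h b)))
∑-repeat-then-one h (suc r) a b =
  trans (cong (λ s → h a + s) (∑-repeat-then-one h r a b)) (x+[r*x+y]≡[1+r]*x+y r (h a) (h b))

∑-repeat-then-two : ∀ (h : ℤ → ℤ) r a b c →
  ∑ (suc (suc r)) (λ i → h (if toℕ i <ᵇ r then a else if toℕ i ≡ᵇ r then b else c))
    ≡ + r * h a + h b + h c
∑-repeat-then-two h 0       a b c = begin
  h b + (h c + + 0)        ≡⟨ cong (λ s → h b + s) (+-identityʳ (h c)) ⟩
  h b + h c                ≡⟨ cong (_+ h c) (sym (+-identityˡ (h b))) ⟩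
  + 0 * h a + h b + h c    ∎
  where open ≡-Reasoning
∑-repeat-then-two h (suc r) a b c =
  trans (cong (λ s → h a + s) (∑-repeat-then-two h r a b c)) regroup
  where
  open ≡-Reasoning
  regroup : h a + (+ r * h a + h b + h c) ≡ + suc r * h a + h b + h c
  regroup = begin
    h a + (+ r * h a + h b + h c)      ≡⟨ sym (+-assoc (h a) (+ r * h a + h b) (h c)) ⟩
    h a + (+ r * h a + h b) + h c      ≡⟨ cong (_+ h c) (x+[r*x+y]≡[1+r]*x+y r (h a) (h b)) ⟩
    + suc r * h a + h b + h c          ∎

isSolution-repeat-then-one : ∀ r (x y x′ y′ : ℤ) →
  x′ ^ 2 + y′ ^ 2 ≡ x ^ 2 + y ^ 2 →
  x ^ 2 + y ^ 2 ≡ + suc r * x ^ 2 + x′ ^ 2 →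
  IsSolution (suc (suc r))
    (λ i → if toℕ i <ᵇ suc r then x else x′) (λ i → if toℕ i <ᵇ suc r then y else y′)
    (x ^ 2 + y ^ 2)
isSolution-repeat-then-one r x y x′ y′ on-circle′ sum≡ =
  on-circle , trans sum≡ (sym (∑-repeat-then-one (_^ 2) (suc r) x x′))
  where
  on-circle : ∀ i → (if toℕ i <ᵇ suc r then x else x′) ^ 2 + (if toℕ i <ᵇ suc r then y else y′) ^ 2
                    ≡ x ^ 2 + y ^ 2
  on-circle i with toℕ i <ᵇ suc r
  ... | true  = refl
  ... | false = on-circle′

isSolution-repeat-then-two : ∀ r (x y x′ y′ x″ y″ : ℤ) →
  x′ ^ 2 + y′ ^ 2 ≡ x ^ 2 + y ^ 2 →
  x″ ^ 2 + y″ ^ 2 ≡ x ^ 2 + y ^ 2 →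
  x ^ 2 + y ^ 2 ≡ + suc r * x ^ 2 + x′ ^ 2 + x″ ^ 2 →
  IsSolution (suc (suc (suc r)))
    (λ i → if toℕ i <ᵇ suc r then x else if toℕ i ≡ᵇ suc r then x′ else x″)
    (λ i → if toℕ i <ᵇ suc r then y else if toℕ i ≡ᵇ suc r then y′ else y″)
    (x ^ 2 + y ^ 2)
isSolution-repeat-then-two r x y x′ y′ x″ y″ on-circle′ on-circle″ sum≡ =
  on-circle , trans sum≡ (sym (∑-repeat-then-two (_^ 2) (suc r) x x′ x″))
  where
  on-circle : ∀ i → (if toℕ i <ᵇ suc r then x else if toℕ i ≡ᵇ suc r then x′ else x″) ^ 2
                    + (if toℕ i <ᵇ suc r then y else if toℕ i ≡ᵇ suc r then y′ else y″) ^ 2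
                    ≡ x ^ 2 + y ^ 2
  on-circle i with toℕ i <ᵇ suc r | toℕ i ≡ᵇ suc r
  ... | true  | _     = refl
  ... | false | true  = on-circle′
  ... | false | false = on-circle″

-- The two families are written once over this signature, so that each can be read both as
-- integers (agreeing definitionally with Defs) and as syntax for the ring solver.
record Signature (A : Set) : Set where
  infixl 6 _⊕_ _⊖_
  infixl 7 _⊛_
  infixr 8 _↑_
  field
    _⊕_ _⊖_ _⊛_ : A → A → A
    _↑_         : A → ℕ → A
    lit         : ℕ → A

integers : Signature ℤ
integers = record { _⊕_ = _+_ ; _⊖_ = _-_ ; _⊛_ = _*_ ; _↑_ = _^_ ; lit = +_ }

polynomials : ∀ {m} → Signature (Polynomial m)
polynomials = record { _⊕_ = _:+_ ; _⊖_ = _:-_ ; _⊛_ = _:*_ ; _↑_ = _:^_ ; lit = λ k → con (+ k) }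

module Family₁ {A : Set} (S : Signature A) (N t : A) where
  open Signature S

  x₁ y₁ xₙ₋₁ yₙ₋₁ xₙ yₙ : A
  x₁   = lit 8 ⊛ t ⊛ (t ↑ 2 ⊕ lit 1) ⊛ (t ↑ 2 ⊖ lit 1)
  y₁   = (N ⊖ lit 2) ⊛ (t ↑ 2 ⊕ lit 1) ↑ 3
  xₙ₋₁ = (t ↑ 2 ⊖ lit 1) ⊛ ((N ⊖ lit 2) ⊛ t ↑ 4 ⊕ (lit 2 ⊛ N ⊖ lit 20) ⊛ t ↑ 2 ⊕ N ⊖ lit 2)
  yₙ₋₁ = lit 2 ⊛ t ⊛ ((N ⊕ lit 2) ⊛ t ↑ 4 ⊕ (lit 2 ⊛ N ⊖ lit 12) ⊛ t ↑ 2 ⊕ N ⊕ lit 2)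
  xₙ   = lit 2 ⊛ t ⊛ ((N ⊖ lit 6) ⊛ t ↑ 4 ⊕ (lit 2 ⊛ N ⊕ lit 4) ⊛ t ↑ 2 ⊕ N ⊖ lit 6)
  yₙ   = (t ↑ 2 ⊖ lit 1) ⊛ ((N ⊖ lit 2) ⊛ t ↑ 4 ⊕ (lit 2 ⊛ N ⊕ lit 12) ⊛ t ↑ 2 ⊕ N ⊖ lit 2)

module Family₂ {A : Set} (S : Signature A) (N m t : A) where
  open Signature S

  x₁ y₁ xₙ yₙ : A
  x₁ = lit 2 ⊛ t
  y₁ = (N ⊖ lit 2) ⊛ t ↑ 2 ⊕ lit 1
  xₙ = (N ⊖ lit 2) ⊛ t ↑ 2 ⊖ lit 1
  yₙ = lit 2 ⊛ m ⊛ t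

module ℤFamily₁ (N t : ℤ) = Family₁ integers N t

family₁-on-circleₙ₋₁ : ∀ N t → let open ℤFamily₁ N t in xₙ₋₁ ^ 2 + yₙ₋₁ ^ 2 ≡ x₁ ^ 2 + y₁ ^ 2
family₁-on-circleₙ₋₁ = solve 2 (λ N t → let open Family₁ polynomials N t in
  xₙ₋₁ :^ 2 :+ yₙ₋₁ :^ 2 := x₁ :^ 2 :+ y₁ :^ 2) refl

family₁-on-circleₙ : ∀ N t → let open ℤFamily₁ N t in xₙ ^ 2 + yₙ ^ 2 ≡ x₁ ^ 2 + y₁ ^ 2
family₁-on-circleₙ = solve 2 (λ N t → let open Family₁ polynomials N t in
  xₙ :^ 2 :+ yₙ :^ 2 := x₁ :^ 2 :+ y₁ :^ 2) refl

family₁-sum : ∀ N t → let open ℤFamily₁ N t in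
  x₁ ^ 2 + y₁ ^ 2 ≡ (N - + 2) * x₁ ^ 2 + xₙ₋₁ ^ 2 + xₙ ^ 2
family₁-sum = solve 2 (λ N t → let open Family₁ polynomials N t in
  x₁ :^ 2 :+ y₁ :^ 2 := (N :- con (+ 2)) :* x₁ :^ 2 :+ xₙ₋₁ :^ 2 :+ xₙ :^ 2) refl

module ℤFamily₂ (N m t : ℤ) = Family₂ integers N m t

family₂-on-circleₙ : ∀ N m t → N ≡ m * m + + 1 →
  let open ℤFamily₂ N m t in xₙ ^ 2 + yₙ ^ 2 ≡ x₁ ^ 2 + y₁ ^ 2
family₂-on-circleₙ _ m t refl =
  solve 2 (λ m t → let open Family₂ polynomials (m :* m :+ con (+ 1)) m t in
    xₙ :^ 2 :+ yₙ :^ 2 := x₁ :^ 2 :+ y₁ :^ 2) refl m t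

family₂-sum : ∀ N m t → let open ℤFamily₂ N m t in x₁ ^ 2 + y₁ ^ 2 ≡ (N - + 1) * x₁ ^ 2 + xₙ ^ 2
family₂-sum = solve 3 (λ N m t → let open Family₂ polynomials N m t in
  x₁ :^ 2 :+ y₁ :^ 2 := (N :- con (+ 1)) :* x₁ :^ 2 :+ xₙ :^ 2) refl

part-i : (n : ℕ) → 3 ≤ n → (t : ℤ) →
  IsSolution n (solI-x n t) (solI-y n t) (s₁ n (solI-x n t) (solI-y n t))
part-i (suc (suc (suc k))) (s≤s (s≤s (s≤s _))) t =
  isSolution-repeat-then-two k x₁ y₁ xₙ₋₁ yₙ₋₁ xₙ yₙ
    (family₁-on-circleₙ₋₁ N t) (family₁-on-circleₙ N t) (family₁-sum N t)
  where
  N : ℤ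
  N = + suc (suc (suc k))
  open ℤFamily₁ N t

part-ii : (m n : ℕ) → 2 ≤ m → n ≡ m ℕ.* m ℕ.+ 1 → (t : ℤ) →
  IsSolution n (solII-x n m t) (solII-y n m t) (s₁ n (solII-x n m t) (solII-y n m t))
part-ii m _ (s≤s (s≤s _)) refl t =
  isSolution-repeat-then-one _ x₁ y₁ xₙ yₙ
    (family₂-on-circleₙ N (+ m) t N≡m²+1) (family₂-sum N (+ m) t)
  where
  N : ℤ
  N = + (m ℕ.* m ℕ.+ 1)
  N≡m²+1 : N ≡ + m * + m + + 1
  N≡m²+1 = trans (pos-+ (m ℕ.* m) 1) (cong (_+ + 1) (pos-* m m))
  open ℤFamily₂ N (+ m) t

corollary1 :
    ((n : ℕ) → 3 ≤ n → (t : ℤ) →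
       IsSolution n (solI-x n t) (solI-y n t) (s₁ n (solI-x n t) (solI-y n t)))
    ×
    ((m n : ℕ) → 2 ≤ m → n ≡ m ℕ.* m ℕ.+ 1 → (t : ℤ) →
       IsSolution n (solII-x n m t) (solII-y n m t) (s₁ n (solII-x n m t) (solII-y n m t)))
corollary1 = part-i , part-ii
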